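{- Let $\eta\ge 0$, $k\le d$, and let $b_1,\dots,b_d$ be positive numbers such that for every $\ell\in[k]$, \[ b_\ell\geq\max_{i\in[d]\setminus\{1,\dots,\ell-1\}} b_i-\eta . \] Let $b'_1,\dots,b'_d$ be obtained by swapping $b_{j_1}$ and $b_{j_2}$ for some $j_2>j_1$ with $b_{j_2}\geq b_{j_1}$ (all other values unchanged). Then for every $\ell\in[k]$, \[ b'_\ell\geq\max_{i\in[d]\setminus\{1,\dots,\ell-1\}} b'_i-\eta . \]
   Formalization: The numbers $b_1,\dots,b_d$ and the parameter $\eta$ are rational. -}

module Defs where

open import Data.Nat using (ℕ; suc; _+_; _∸_; _≟_)
open import Data.List using (List; map; foldr; upTo)
open import Data.Rational using (ℚ; _⊔_)
open import Relation.Nullary using (yes; no)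

-- Sequences b₁,…,b_d are modelled as functions ℕ → ℚ, using indices 1..d.

segment : ℕ → ℕ → List ℕ
segment ℓ d = map (λ j → ℓ + j) (upTo (suc (d ∸ ℓ)))

-- max_{i ∈ [d] \ {1,…,ℓ-1}} b_i  (for 1 ≤ ℓ ≤ d; the seed b ℓ belongs to the range)
maxFrom : (ℕ → ℚ) → ℕ → ℕ → ℚ
maxFrom b ℓ d = foldr _⊔_ (b ℓ) (map b (segment ℓ d))

swap : (ℕ → ℚ) → ℕ → ℕ → ℕ → ℚ
swap b j₁ j₂ i with i ≟ j₁
... | yes _ = b j₂
... | no _ with i ≟ j₂
...   | yes _ = b j₁
...   | no _ = b i

{-# OPTIONS --safe #-}
module Submission where

-- Moving the larger of two values to the later position never raises a tail
-- maximum: every entry of b' on [ℓ, d] is bounded by an entry of b on [ℓ, d].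
-- So at ℓ ∉ {j₁, j₂} the condition for b' follows from the one for b, and at
-- ℓ = j₁ the entry has only grown.  At ℓ = j₂ the new entry is b_{j₁}, and the
-- tail of b' from j₂ consists of values of b from j₁ on, so the condition for b
-- at j₁ gives the one for b' at j₂.

open import Defs
open import Data.Nat as ℕ using (ℕ; _≟_) renaming (_≤_ to _≤ℕ_; _<_ to _<ℕ_)
import Data.Nat.Properties as ℕ
open import Data.Rational using (ℚ; 0ℚ; _≤_; _<_; _-_; _⊔_; -_)
open import Data.Rational.Properties
  using (≤-reflexive; ≤-trans; ⊔-lub; p≤q⇒p≤q⊔r; p≤q⇒p≤r⊔q; +-monoˡ-≤; module ≤-Reasoning)
open import Data.List using (map)
open import Data.List.Properties using (foldr-preservesᵇ; foldr-preservesᵒ)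
open import Data.List.Membership.Propositional using (_∈_)
open import Data.List.Membership.Propositional.Properties using (∈-map⁺; ∈-map⁻; ∈-upTo⁺; ∈-upTo⁻)
import Data.List.Relation.Unary.All as All
import Data.List.Relation.Unary.All.Properties as All
import Data.List.Relation.Unary.Any as Any
import Data.List.Relation.Unary.Any.Properties as Any
open import Data.Product using (_×_; _,_)
open import Data.Sum using (inj₂; [_,_])
open import Data.Empty using (⊥-elim)
open import Function using (_∘_)
open import Relation.Binary.PropositionalEquality using (_≡_; _≢_; refl; cong; subst)
open import Relation.Nullary using (yes; no)

∈-segment⁺ : ∀ {ℓ d i} → ℓ ≤ℕ i → i ≤ℕ d → i ∈ segment ℓ d
∈-segment⁺ {ℓ} {d} ℓ≤i i≤d =
  subst (_∈ segment ℓ d) (ℕ.m+[n∸m]≡n ℓ≤i)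
    (∈-map⁺ (ℓ ℕ.+_) (∈-upTo⁺ (ℕ.s≤s (ℕ.∸-monoˡ-≤ ℓ i≤d))))

∈-segment⁻ : ∀ {ℓ d i} → ℓ ≤ℕ d → i ∈ segment ℓ d → ℓ ≤ℕ i × i ≤ℕ d
∈-segment⁻ {ℓ} ℓ≤d i∈ with j , j∈ , refl ← ∈-map⁻ (ℓ ℕ.+_) i∈ =
  ℕ.m≤m+n ℓ j ,
  ℕ.≤-trans (ℕ.+-monoʳ-≤ ℓ (ℕ.≤-pred (∈-upTo⁻ j∈))) (ℕ.≤-reflexive (ℕ.m+[n∸m]≡n ℓ≤d))

maxFrom-lub : ∀ (f : ℕ → ℚ) {ℓ d c} → ℓ ≤ℕ d →
              (∀ i → ℓ ≤ℕ i → i ≤ℕ d → f i ≤ c) → maxFrom f ℓ d ≤ c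
maxFrom-lub f {c = c} ℓ≤d bound =
  foldr-preservesᵇ {P = _≤ c} ⊔-lub (bound _ ℕ.≤-refl ℓ≤d)
    (All.map⁺ (All.tabulate (λ i∈ → let ℓ≤i , i≤d = ∈-segment⁻ ℓ≤d i∈ in bound _ ℓ≤i i≤d)))

≤-maxFrom : ∀ (f : ℕ → ℚ) {ℓ d i} → ℓ ≤ℕ i → i ≤ℕ d → f i ≤ maxFrom f ℓ d
≤-maxFrom f {i = i} ℓ≤i i≤d =
  foldr-preservesᵒ {P = f i ≤_} (λ x y → [ p≤q⇒p≤q⊔r y , p≤q⇒p≤r⊔q x ]) _ _
    (inj₂ (Any.map⁺ (Any.map (≤-reflexive ∘ cong f) (∈-segment⁺ ℓ≤i i≤d))))

p≤q⇒p-r≤q-r : ∀ {p q} r → p ≤ q → p - r ≤ q - r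
p≤q⇒p-r≤q-r r = +-monoˡ-≤ (- r)

data SwapPosition (j₁ j₂ : ℕ) : ℕ → Set where
  at-j₁     : SwapPosition j₁ j₂ j₁
  at-j₂     : SwapPosition j₁ j₂ j₂
  elsewhere : ∀ {i} → i ≢ j₁ → i ≢ j₂ → SwapPosition j₁ j₂ i

swapPosition : ∀ j₁ j₂ i → SwapPosition j₁ j₂ i
swapPosition j₁ j₂ i with i ≟ j₁ | i ≟ j₂
... | yes refl | _        = at-j₁
... | no _     | yes refl = at-j₂
... | no i≢j₁  | no i≢j₂  = elsewhere i≢j₁ i≢j₂

swap-at-j₁ : ∀ (b : ℕ → ℚ) j₁ j₂ → swap b j₁ j₂ j₁ ≡ b j₂
swap-at-j₁ b j₁ j₂ with j₁ ≟ j₁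
... | yes _    = refl
... | no j₁≢j₁ = ⊥-elim (j₁≢j₁ refl)

swap-at-j₂ : ∀ (b : ℕ → ℚ) {j₁ j₂} → j₂ ≢ j₁ → swap b j₁ j₂ j₂ ≡ b j₁
swap-at-j₂ b {j₁} {j₂} j₂≢j₁ with j₂ ≟ j₁
... | yes j₂≡j₁ = ⊥-elim (j₂≢j₁ j₂≡j₁)
... | no _ with j₂ ≟ j₂
...   | yes _    = refl
...   | no j₂≢j₂ = ⊥-elim (j₂≢j₂ refl)

swap-elsewhere : ∀ (b : ℕ → ℚ) {j₁ j₂ i} → i ≢ j₁ → i ≢ j₂ → swap b j₁ j₂ i ≡ b i
swap-elsewhere b {j₁} {j₂} {i} i≢j₁ i≢j₂ with i ≟ j₁
... | yes i≡j₁ = ⊥-elim (i≢j₁ i≡j₁)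
... | no _ with i ≟ j₂
...   | yes i≡j₂ = ⊥-elim (i≢j₂ i≡j₂)
...   | no _     = refl

module _ (b : ℕ → ℚ) {j₁ j₂ : ℕ} (j₁<j₂ : j₁ <ℕ j₂) where

  private
    b' : ℕ → ℚ
    b' = swap b j₁ j₂

  maxFrom-swap≤maxFrom : ∀ {ℓ d} → b j₁ ≤ b j₂ → j₂ ≤ℕ d → ℓ ≤ℕ d → maxFrom b' ℓ d ≤ maxFrom b ℓ d
  maxFrom-swap≤maxFrom {ℓ} {d} bj₁≤bj₂ j₂≤d ℓ≤d = maxFrom-lub b' ℓ≤d bounded
    where
    bounded : ∀ i → ℓ ≤ℕ i → i ≤ℕ d → b' i ≤ maxFrom b ℓ d
    bounded i ℓ≤i i≤d with i ≟ j₁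
    ... | yes refl = ≤-maxFrom b (ℕ.≤-trans ℓ≤i (ℕ.<⇒≤ j₁<j₂)) j₂≤d
    ... | no _ with i ≟ j₂
    ...   | yes refl = ≤-trans bj₁≤bj₂ (≤-maxFrom b ℓ≤i i≤d)
    ...   | no _     = ≤-maxFrom b ℓ≤i i≤d

  maxFrom-swap-j₂≤maxFrom-j₁ : ∀ {d} → j₂ ≤ℕ d → maxFrom b' j₂ d ≤ maxFrom b j₁ d
  maxFrom-swap-j₂≤maxFrom-j₁ {d} j₂≤d = maxFrom-lub b' j₂≤d bounded
    where
    bounded : ∀ i → j₂ ≤ℕ i → i ≤ℕ d → b' i ≤ maxFrom b j₁ d
    bounded i j₂≤i i≤d with i ≟ j₁
    ... | yes refl = ⊥-elim (ℕ.<⇒≱ j₁<j₂ j₂≤i)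
    ... | no _ with i ≟ j₂
    ...   | yes refl = ≤-maxFrom b ℕ.≤-refl (ℕ.≤-trans (ℕ.<⇒≤ j₁<j₂) i≤d)
    ...   | no _     = ≤-maxFrom b (ℕ.≤-trans (ℕ.<⇒≤ j₁<j₂) j₂≤i) i≤d

claim4p7 : (d k : ℕ) (η : ℚ) (b : ℕ → ℚ) (j₁ j₂ : ℕ) →
    0ℚ ≤ η → k ≤ℕ d →
    (∀ i → 1 ≤ℕ i → i ≤ℕ d → 0ℚ < b i) →
    (∀ ℓ → 1 ≤ℕ ℓ → ℓ ≤ℕ k → maxFrom b ℓ d - η ≤ b ℓ) →
    1 ≤ℕ j₁ → j₁ <ℕ j₂ → j₂ ≤ℕ d → b j₁ ≤ b j₂ →
    ∀ ℓ → 1 ≤ℕ ℓ → ℓ ≤ℕ k → maxFrom (swap b j₁ j₂) ℓ d - η ≤ swap b j₁ j₂ ℓ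
claim4p7 d k η b j₁ j₂ _ k≤d _ gap 1≤j₁ j₁<j₂ j₂≤d bj₁≤bj₂ ℓ 1≤ℓ ℓ≤k with swapPosition j₁ j₂ ℓ
... | at-j₁ = begin
  maxFrom (swap b j₁ j₂) j₁ d - η
    ≤⟨ p≤q⇒p-r≤q-r η (maxFrom-swap≤maxFrom b j₁<j₂ bj₁≤bj₂ j₂≤d (ℕ.≤-trans ℓ≤k k≤d)) ⟩
  maxFrom b j₁ d - η  ≤⟨ gap j₁ 1≤j₁ ℓ≤k ⟩
  b j₁                ≤⟨ bj₁≤bj₂ ⟩
  b j₂                ≡⟨ swap-at-j₁ b j₁ j₂ ⟨
  swap b j₁ j₂ j₁     ∎
  where open ≤-Reasoning
... | at-j₂ = begin
  maxFrom (swap b j₁ j₂) j₂ d - η  ≤⟨ p≤q⇒p-r≤q-r η (maxFrom-swap-j₂≤maxFrom-j₁ b j₁<j₂ j₂≤d) ⟩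
  maxFrom b j₁ d - η               ≤⟨ gap j₁ 1≤j₁ (ℕ.≤-trans (ℕ.<⇒≤ j₁<j₂) ℓ≤k) ⟩
  b j₁                             ≡⟨ swap-at-j₂ b (ℕ.>⇒≢ j₁<j₂) ⟨
  swap b j₁ j₂ j₂                  ∎
  where open ≤-Reasoning
... | elsewhere ℓ≢j₁ ℓ≢j₂ = begin
  maxFrom (swap b j₁ j₂) ℓ d - η
    ≤⟨ p≤q⇒p-r≤q-r η (maxFrom-swap≤maxFrom b j₁<j₂ bj₁≤bj₂ j₂≤d (ℕ.≤-trans ℓ≤k k≤d)) ⟩
  maxFrom b ℓ d - η  ≤⟨ gap ℓ 1≤ℓ ℓ≤k ⟩
  b ℓ                ≡⟨ swap-elsewhere b ℓ≢j₁ ℓ≢j₂ ⟨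
  swap b j₁ j₂ ℓ     ∎
  where open ≤-Reasoning
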